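{- Let $n\ge1$ and let $\sigma\in S_n$ with B-code $b=(b_1,b_2,\ldots,b_n)$. Then $$sor(\sigma)=\sum_{i=1}^n (i-b_i)\qquad\text{and}\qquad cyc(\sigma)=|\mathrm{Max}\,b|.$$
   Context: $S_n$ is the set of permutations of $[n]$, viewed as bijections of $[n]$, with product $(\pi\sigma)(i)=\pi(\sigma(i))$. Every $\sigma\in S_n$ has a unique decomposition into transpositions $\sigma=(i_1,j_1)(i_2,j_2)\cdots(i_k,j_k)$ with $j_1<j_2<\cdots<j_k$ and $i_r<j_r$ for all $r$; the sorting index is $sor(\sigma)=\sum_{r=1}^k (j_r-i_r)$. $cyc(\sigma)$ is the number of cycles of $\sigma$ (fixed points counted). The B-code of $\sigma$ is $(b_1,\ldots,b_n)$ where, for each $i$, $k_i$ is the smallest integer $k\ge1$ with $\sigma^{ -k}(i)\le i$ and $b_i=\sigma^{ -k_i}(i)$. For a sequence $b$ with $1\le b_i\le i$, $\mathrm{Max}\,b=\{i: b_i=i\}$. -}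

module Defs where

open import Data.Nat using (ℕ; zero; suc; _∸_; _≤_)
open import Data.Fin as Fin using (Fin; toℕ; _≟_)
open import Data.Fin.Properties using (any?)
open import Data.Fin.Permutation using (Permutation′; _⟨$⟩ʳ_; _⟨$⟩ˡ_)
open import Data.Product using (_×_; _,_; proj₁; proj₂; Σ)
open import Data.Nat.ListAction using (sum)
open import Data.List using (List; []; _∷_; map; length; filter; allFin; deduplicate)
open import Data.List.Relation.Unary.Linked using (Linked)
open import Data.List.Relation.Unary.All using (All)
open import Data.Vec using (Vec; tabulate)
import Data.Vec.Properties as VecP
import Data.Bool as Bool
open import Relation.Nullary using (does)
open import Relation.Binary.PropositionalEquality using (_≡_)

-- Permutations of [n] are modelled as Permutation′ n (bijections of Fin n,
-- where Fin n = {0,…,n-1} stands for [n] = {1,…,n} via i ↦ i+1).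

iter : {A : Set} → (A → A) → ℕ → A → A
iter f zero    x = x
iter f (suc k) x = f (iter f k x)

pow : ∀ {n} → Permutation′ n → ℕ → Fin n → Fin n
pow σ k = iter (σ ⟨$⟩ʳ_) k

powInv : ∀ {n} → Permutation′ n → ℕ → Fin n → Fin n
powInv σ k = iter (σ ⟨$⟩ˡ_) k

swap : ∀ {n} → Fin n → Fin n → Fin n → Fin n
swap i j x with does (x ≟ i)
... | Bool.true = j
... | Bool.false with does (x ≟ j)
...   | Bool.true = i
...   | Bool.false = x

-- product (i₁,j₁)(i₂,j₂)⋯(i_k,j_k) with (πσ)(x) = π(σ(x))
prodT : ∀ {n} → List (Fin n × Fin n) → Fin n → Fin n
prodT []             x = x
prodT ((i , j) ∷ ts) x = swap i j (prodT ts x)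

IsSortDecomp : ∀ {n} → Permutation′ n → List (Fin n × Fin n) → Set
IsSortDecomp σ ts =
  All (λ p → proj₁ p Fin.< proj₂ p) ts ×
  Linked (λ p q → proj₂ p Fin.< proj₂ q) ts ×
  (∀ x → prodT ts x ≡ σ ⟨$⟩ʳ x)

sorOf : ∀ {n} → List (Fin n × Fin n) → ℕ
sorOf ts = sum (map (λ p → toℕ (proj₂ p) ∸ toℕ (proj₁ p)) ts)

-- Number of cycles: number of distinct orbits { σ^k(i) : k ≥ 0 }.
-- Since every orbit has at most n elements, k ranges over 0,…,n-1.

orbit : ∀ {n} → Permutation′ n → Fin n → Vec Bool.Bool n
orbit {n} σ i = tabulate (λ j → does (any? (λ (k : Fin n) → pow σ (toℕ k) i ≟ j)))

cyc : ∀ {n} → Permutation′ n → ℕ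
cyc {n} σ = length (deduplicate (VecP.≡-dec Bool._≟_) (map (orbit σ) (allFin n)))

IsBCode : ∀ {n} → Permutation′ n → (Fin n → Fin n) → Set
IsBCode σ b = ∀ i → Σ ℕ λ k →
  (1 ≤ k) × (powInv σ k i ≡ b i) × (b i Fin.≤ i) ×
  (∀ m → 1 ≤ m → m Data.Nat.< k → i Fin.< powInv σ m i)

sumDiff : ∀ {n} → (Fin n → Fin n) → ℕ
sumDiff {n} b = sum (map (λ i → toℕ i ∸ toℕ (b i)) (allFin n))

-- |Max b| = #{ i : b_i = i }
maxCount : ∀ {n} → (Fin n → Fin n) → ℕ
maxCount {n} b = length (filter (λ i → b i ≟ i) (allFin n))

-- Read backwards, the sorting decomposition writes σ⁻¹ = (i_k j_k) ⋯ (i_1 j_1) with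
-- j_k the largest j, and b_x is the first point ≤ x on the walk x, σ⁻¹x, σ⁻²x, ….
-- Dropping the factor (i_k j_k) only cuts j_k out of the cycle through i_k, so it
-- changes the B-code only at j_k, from b_{j_k} = i_k to j_k: Σ (x − b_x) drops by
-- j_k − i_k, and induction on k gives sor σ = Σ (x − b_x).  For the cycles: b_x = x
-- exactly when x is the least element of its cycle, and iterating b from any x
-- descends to that least element, so Max b is a set of cycle representatives.

module Submission where

open import Defs
open import Data.Bool using (true)
import Data.Bool as Bool
open import Data.Bool.Properties using (T-≡)
open import Data.Empty using (⊥-elim)
open import Data.Fin as Fin using (Fin; toℕ; fromℕ<; _≟_)
open import Data.Fin.Induction using (<-wellFounded)
open import Data.Fin.Properties as Finₚ using (any?)
open import Data.Fin.Permutation using (Permutation′; _⟨$⟩ʳ_; _⟨$⟩ˡ_; inverseˡ; inverseʳ)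
open import Data.List using (List; []; _∷_; _++_; map; filter; length; allFin; tabulate; reverse; deduplicate)
open import Data.List.Membership.Propositional using (_∈_)
open import Data.List.Membership.Propositional.Properties using (∈-map⁺; ∈-map⁻; ∈-filter⁺; ∈-allFin; deduplicate-∈⇔)
open import Data.List.Membership.Propositional.Properties.WithK using (unique∧set⇒bag)
import Data.List.Properties as Listₚ
open import Data.List.Relation.Binary.BagAndSetEquality using (∼bag⇒↭)
open import Data.List.Relation.Binary.Permutation.Propositional using (↭-sym)
open import Data.List.Relation.Binary.Permutation.Propositional.Properties using (↭-reverse; ↭-length; All-resp-↭)
import Data.List.Relation.Binary.Permutation.Propositional.Properties as Permₚ
open import Data.List.Relation.Unary.All as All using (All; []; _∷_)
import Data.List.Relation.Unary.All.Properties as Allₚ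
open import Data.List.Relation.Unary.AllPairs using (AllPairs; []; _∷_)
import Data.List.Relation.Unary.AllPairs.Properties as AllPairsₚ
open import Data.List.Relation.Unary.Linked.Properties using (Linked⇒AllPairs)
open import Data.List.Relation.Unary.Unique.Propositional using (Unique)
import Data.List.Relation.Unary.Unique.Propositional.Properties as Uniqueₚ
open import Data.List.Relation.Unary.Unique.DecPropositional.Properties using (deduplicate-!)
open import Data.Nat as ℕ using (ℕ; zero; suc; _+_; _*_; _∸_; z≤n; s≤s)
import Data.Nat.Properties as ℕₚ
open import Data.Nat.DivMod using (_%_; _/_; m≡m%n+[m/n]*n; m%n<n)
open import Data.Nat.ListAction using (sum)
open import Data.Nat.ListAction.Properties using (sum-↭)
open import Data.Product using (∃; ∃-syntax; _×_; _,_; proj₁; proj₂)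
import Data.Vec as Vec
import Data.Vec.Properties as Vecₚ
open import Data.Vec.Functional using (updateAt)
open import Data.Vec.Functional.Properties using (updateAt-updates; updateAt-minimal)
open import Algebra.Properties.CommutativeSemigroup ℕₚ.+-commutativeSemigroup using (x∙yz≈y∙xz)
open import Function using (_∘_; id; const; flip; Injective)
open import Function.Bundles using (mk⇔; Equivalence)
open import Induction.WellFounded using (Acc; acc)
open import Relation.Binary.Definitions using (DecidableEquality; tri<; tri≈; tri>)
open import Relation.Binary.PropositionalEquality
open import Relation.Nullary using (Dec; yes; no; does)
open import Relation.Nullary.Decidable using (dec-true; does-⇔; isYes≗does; toWitness)
open import Relation.Unary using (Decidable)

private
  variable
    n : ℕ

module _ {A : Set} (f : A → A) where

  iter-+ : ∀ k l x → iter f (k + l) x ≡ iter f k (iter f l x)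
  iter-+ zero    l x = refl
  iter-+ (suc k) l x = cong f (iter-+ k l x)

  iter-sucʳ : ∀ k x → iter f k (f x) ≡ iter f (suc k) x
  iter-sucʳ zero    x = refl
  iter-sucʳ (suc k) x = cong f (iter-sucʳ k x)

  iter-periodic : ∀ {p x} → iter f p x ≡ x → ∀ q → iter f (q * p) x ≡ x
  iter-periodic         e zero    = refl
  iter-periodic {p} {x} e (suc q) =
    trans (iter-+ p (q * p) x) (trans (cong (iter f p) (iter-periodic e q)) e)

  iter-% : ∀ {p x} .{{_ : ℕ.NonZero p}} → iter f p x ≡ x → ∀ m → iter f m x ≡ iter f (m % p) x
  iter-% {p} {x} e m = begin
    iter f m x                            ≡⟨ cong (λ k → iter f k x) (m≡m%n+[m/n]*n m p) ⟩
    iter f (m % p + m / p * p) x          ≡⟨ iter-+ (m % p) (m / p * p) x ⟩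
    iter f (m % p) (iter f (m / p * p) x) ≡⟨ cong (iter f (m % p)) (iter-periodic e (m / p)) ⟩
    iter f (m % p) x                      ∎
    where open ≡-Reasoning

iter-inverseˡ : ∀ {A : Set} {f g : A → A} → (∀ x → g (f x) ≡ x) → ∀ k x → iter g k (iter f k x) ≡ x
iter-inverseˡ         gf zero    x = refl
iter-inverseˡ {f = f} {g} gf (suc k) x = begin
  iter g (suc k) (f (iter f k x)) ≡⟨ iter-sucʳ g k _ ⟨
  iter g k (g (f (iter f k x)))   ≡⟨ cong (iter g k) (gf _) ⟩
  iter g k (iter f k x)           ≡⟨ iter-inverseˡ gf k x ⟩
  x                               ∎
  where open ≡-Reasoning

-- FirstBelow h x z y: y is the first of h z, h² z, … that is ≤ x.
module _ (h : Fin n → Fin n) (x : Fin n) where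

  data FirstBelow : Fin n → Fin n → Set where
    stop : ∀ {z y}   → h z ≡ y → y Fin.≤ x → FirstBelow z y
    step : ∀ {z u y} → h z ≡ u → x Fin.< u → FirstBelow u y → FirstBelow z y

module _ {h : Fin n → Fin n} {x : Fin n} where

  FirstBelow-functional : ∀ {z y y′} → FirstBelow h x z y → FirstBelow h x z y′ → y ≡ y′
  FirstBelow-functional (stop refl _)     (stop refl _)     = refl
  FirstBelow-functional (stop refl y≤x)   (step refl x<u _) = ⊥-elim (ℕₚ.<⇒≱ x<u y≤x)
  FirstBelow-functional (step refl x<u _) (stop refl y≤x)   = ⊥-elim (ℕₚ.<⇒≱ x<u y≤x)
  FirstBelow-functional (step refl _ w)   (step refl _ w′)  = FirstBelow-functional w w′

  FirstBelow-cong : ∀ {g z y} → (∀ u → h u ≡ g u) → FirstBelow h x z y → FirstBelow g x z y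
  FirstBelow-cong h≗g (stop e y≤x)   = stop (trans (sym (h≗g _)) e) y≤x
  FirstBelow-cong h≗g (step e x<u w) = step (trans (sym (h≗g _)) e) x<u (FirstBelow-cong h≗g w)

  FirstBelow-fixedPoint : ∀ {y} → h x ≡ x → FirstBelow h x x y → y ≡ x
  FirstBelow-fixedPoint hx≡x (stop e _)     = trans (sym e) hx≡x
  FirstBelow-fixedPoint hx≡x (step e x<u _) =
    ⊥-elim (Finₚ.<-irrefl refl (subst (x Fin.<_) (trans (sym e) hx≡x) x<u))

  iter⇒FirstBelow : ∀ {y} K z → iter h (suc K) z ≡ y → y Fin.≤ x →
                    (∀ k → k ℕ.< K → x Fin.< iter h (suc k) z) → FirstBelow h x z y
  iter⇒FirstBelow zero    z e y≤x above = stop e y≤x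
  iter⇒FirstBelow (suc K) z e y≤x above = step refl (above 0 (s≤s z≤n))
    (iter⇒FirstBelow K (h z) (trans (iter-sucʳ h (suc K) z) e) y≤x
      (λ k k<K → subst (x Fin.<_) (sym (iter-sucʳ h (suc k) z)) (above (suc k) (s≤s k<K))))

  FirstBelow-return⇒≤-iter : FirstBelow h x x x → ∀ m → x Fin.≤ iter h m x
  FirstBelow-return⇒≤-iter return m = proj₁ (invariant m)
    where
      invariant : ∀ m → x Fin.≤ iter h m x × FirstBelow h x (iter h m x) x
      invariant zero    = Finₚ.≤-refl , return
      invariant (suc m) with invariant m
      ... | _ , stop e _     =
        subst (x Fin.≤_) (sym e) Finₚ.≤-refl , subst (λ t → FirstBelow h x t x) (sym e) return
      ... | _ , step e x<u w =
        ℕₚ.<⇒≤ (subst (x Fin.<_) (sym e) x<u) , subst (λ t → FirstBelow h x t x) (sym e) w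

IsBCode⇒FirstBelow : ∀ {σ : Permutation′ n} {b} → IsBCode σ b →
                     ∀ x → FirstBelow (σ ⟨$⟩ˡ_) x x (b x)
IsBCode⇒FirstBelow bc x with bc x
... | suc K , _ , e , b≤x , above =
  iter⇒FirstBelow K x e b≤x (λ k k<K → above (suc k) (s≤s z≤n) (s≤s k<K))

module _ (i j : Fin n) where

  swap-matchˡ : swap i j i ≡ j
  swap-matchˡ with i ≟ i
  ... | yes _   = refl
  ... | no i≢i = ⊥-elim (i≢i refl)

  swap-matchʳ : swap i j j ≡ i
  swap-matchʳ with j ≟ i
  ... | yes j≡i = j≡i
  ... | no _ with j ≟ j
  ...   | yes _   = refl
  ...   | no j≢j = ⊥-elim (j≢j refl)

  swap-mismatch : ∀ {x} → x ≢ i → x ≢ j → swap i j x ≡ x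
  swap-mismatch {x} x≢i x≢j with x ≟ i
  ... | yes x≡i = ⊥-elim (x≢i x≡i)
  ... | no _ with x ≟ j
  ...   | yes x≡j = ⊥-elim (x≢j x≡j)
  ...   | no _    = refl

  swap-involutive : ∀ x → swap i j (swap i j x) ≡ x
  swap-involutive x = by-cases (x ≟ i) (x ≟ j)
    where
      by-cases : Dec (x ≡ i) → Dec (x ≡ j) → swap i j (swap i j x) ≡ x
      by-cases (yes refl) _          = trans (cong (swap i j) swap-matchˡ) swap-matchʳ
      by-cases (no _)     (yes refl) = trans (cong (swap i j) swap-matchʳ) swap-matchˡ
      by-cases (no x≢i)   (no x≢j)   =
        trans (cong (swap i j) (swap-mismatch x≢i x≢j)) (swap-mismatch x≢i x≢j)

prodT-++ : ∀ (ts us : List (Fin n × Fin n)) x → prodT (ts ++ us) x ≡ prodT ts (prodT us x)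
prodT-++ []             us x = refl
prodT-++ ((i , j) ∷ ts) us x = cong (swap i j) (prodT-++ ts us x)

prodT-reverse-inverse : ∀ (ts : List (Fin n × Fin n)) x → prodT (reverse ts) (prodT ts x) ≡ x
prodT-reverse-inverse []             x = refl
prodT-reverse-inverse ((i , j) ∷ ts) x = begin
  prodT (reverse ((i , j) ∷ ts)) y                   ≡⟨ cong (λ us → prodT us y) (Listₚ.unfold-reverse (i , j) ts) ⟩
  prodT (reverse ts ++ (i , j) ∷ []) y               ≡⟨ prodT-++ (reverse ts) _ y ⟩
  prodT (reverse ts) (swap i j (swap i j (prodT ts x))) ≡⟨ cong (prodT (reverse ts)) (swap-involutive i j _) ⟩
  prodT (reverse ts) (prodT ts x)                    ≡⟨ prodT-reverse-inverse ts x ⟩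
  x                                                  ∎
  where
    open ≡-Reasoning
    y : Fin _
    y = swap i j (prodT ts x)

prodT-injective : ∀ (ts : List (Fin n × Fin n)) → Injective _≡_ _≡_ (prodT ts)
prodT-injective ts {x} {y} e = begin
  x                               ≡⟨ prodT-reverse-inverse ts x ⟨
  prodT (reverse ts) (prodT ts x) ≡⟨ cong (prodT (reverse ts)) e ⟩
  prodT (reverse ts) (prodT ts y) ≡⟨ prodT-reverse-inverse ts y ⟩
  y                               ∎
  where open ≡-Reasoning

prodT-fixed : ∀ {y} (ts : List (Fin n × Fin n)) → All (λ t → y ≢ proj₁ t × y ≢ proj₂ t) ts →
              prodT ts y ≡ y
prodT-fixed []             []                   = refl
prodT-fixed ((i , j) ∷ ts) ((y≢i , y≢j) ∷ away) =
  trans (cong (swap i j) (prodT-fixed ts away)) (swap-mismatch i j y≢i y≢j)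

AllPairs-reverse⁺ : ∀ {A : Set} {R : A → A → Set} {xs : List A} →
                    AllPairs R xs → AllPairs (flip R) (reverse xs)
AllPairs-reverse⁺ {R = R} {[]}     []          = []
AllPairs-reverse⁺ {R = R} {x ∷ xs} (Rx ∷ Rxs) =
  subst (AllPairs (flip R)) (sym (Listₚ.unfold-reverse x xs))
    (AllPairsₚ.++⁺ (AllPairs-reverse⁺ Rxs) ([] ∷ [])
      (All.map (_∷ []) (All-resp-↭ (↭-sym (↭-reverse xs)) Rx)))

Descending : List (Fin n × Fin n) → Set
Descending rs = All (λ t → proj₁ t Fin.< proj₂ t) rs
              × AllPairs (λ t u → proj₂ u Fin.< proj₂ t) rs

IsSortDecomp⇒Descending-reverse : ∀ {σ : Permutation′ n} {ts} →
                                  IsSortDecomp σ ts → Descending (reverse ts)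
IsSortDecomp⇒Descending-reverse {ts = ts} (i<j , linked , _) =
  All-resp-↭ (↭-sym (↭-reverse ts)) i<j , AllPairs-reverse⁺ (Linked⇒AllPairs ℕₚ.<-trans linked)

sorOf-reverse : ∀ (ts : List (Fin n × Fin n)) → sorOf (reverse ts) ≡ sorOf ts
sorOf-reverse ts = sum-↭ (Permₚ.map⁺ (λ t → toℕ (proj₂ t) ∸ toℕ (proj₁ t)) (↭-reverse ts))

-- Removing the transposition with the largest j

module RemoveTransposition {i j : Fin n} (i<j : i Fin.< j) (g : Fin n → Fin n)
  (g-injective : Injective _≡_ _≡_ g) (g-fixed : ∀ {y} → j Fin.≤ y → g y ≡ y) where

  h : Fin n → Fin n
  h = swap i j ∘ g

  i≢j : i ≢ j
  i≢j = Finₚ.<⇒≢ i<j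

  h-j : h j ≡ i
  h-j = trans (cong (swap i j) (g-fixed Finₚ.≤-refl)) (swap-matchʳ i j)

  -- The cycles of h are those of g with j inserted between g⁻¹(i) and i, and a walk
  -- looking for a point ≤ x < j passes over j.
  FirstBelow-remove : ∀ {x z y} → x Fin.< j → z ≢ j → FirstBelow h x z y → FirstBelow g x z y
  FirstBelow-remove {x} {z} x<j z≢j w with g z ≟ i
  ... | no gz≢i = bypass w
    where
      gz≢j : g z ≢ j
      gz≢j gz≡j = z≢j (g-injective (trans gz≡j (sym (g-fixed Finₚ.≤-refl))))
      hz≡gz : h z ≡ g z
      hz≡gz = swap-mismatch i j gz≢i gz≢j
      bypass : ∀ {y} → FirstBelow h x z y → FirstBelow g x z y
      bypass (stop e y≤x)   = stop (trans (sym hz≡gz) e) y≤x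
      bypass (step e x<u w) = step (trans (sym hz≡gz) e) x<u
        (FirstBelow-remove x<j (λ u≡j → gz≢j (trans (sym hz≡gz) (trans e u≡j))) w)
  ... | yes gz≡i = through-j w
    where
      hz≡j : h z ≡ j
      hz≡j = trans (cong (swap i j) gz≡i) (swap-matchˡ i j)
      gz≡hhz : g z ≡ h (h z)
      gz≡hhz = trans gz≡i (sym (trans (cong h hz≡j) h-j))
      through-j : ∀ {y} → FirstBelow h x z y → FirstBelow g x z y
      through-j (stop e j≤x) =
        ⊥-elim (ℕₚ.<⇒≱ x<j (subst (Fin._≤ x) (trans (sym e) hz≡j) j≤x))
      through-j (step refl _ (stop hhz≡y y≤x)) = stop (trans gz≡hhz hhz≡y) y≤x
      through-j (step refl _ (step {u = u} hhz≡u x<u w)) = step gz≡u x<u (FirstBelow-remove x<j u≢j w)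
        where
          gz≡u : g z ≡ u
          gz≡u = trans gz≡hhz hhz≡u
          u≢j : u ≢ j
          u≢j u≡j = i≢j (trans (sym gz≡i) (trans gz≡u u≡j))

  module _ {b : Fin n → Fin n} (walks : ∀ x → FirstBelow h x x (b x)) where

    b-j : b j ≡ i
    b-j = FirstBelow-functional (walks j) (stop h-j (ℕₚ.<⇒≤ i<j))

    walks-updateAt : ∀ x → FirstBelow g x x (updateAt b j (const j) x)
    walks-updateAt x with Finₚ.<-cmp x j
    ... | tri< x<j x≢j _ =
      subst (FirstBelow g x x) (sym (updateAt-minimal x j b x≢j)) (FirstBelow-remove x<j x≢j (walks x))
    ... | tri≈ _ refl _ =
      subst (FirstBelow g j j) (sym (updateAt-updates j b)) (stop (g-fixed Finₚ.≤-refl) Finₚ.≤-refl)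
    ... | tri> _ x≢j j<x = stop (trans gx≡x (sym b′x≡x)) (ℕₚ.≤-reflexive (cong toℕ b′x≡x))
      where
        gx≡x : g x ≡ x
        gx≡x = g-fixed (ℕₚ.<⇒≤ j<x)
        hx≡x : h x ≡ x
        hx≡x = trans (cong (swap i j) gx≡x)
          (swap-mismatch i j (λ x≡i → ℕₚ.<-asym i<j (subst (j Fin.<_) x≡i j<x)) x≢j)
        b′x≡x : updateAt b j (const j) x ≡ x
        b′x≡x = trans (updateAt-minimal x j b x≢j) (FirstBelow-fixedPoint hx≡x (walks x))

-- The sorting index

sum-map-zeros : ∀ {A : Set} (f : A → ℕ) xs → (∀ x → f x ≡ 0) → sum (map f xs) ≡ 0
sum-map-zeros f []       _  = refl
sum-map-zeros f (x ∷ xs) f≡0 = cong₂ _+_ (f≡0 x) (sum-map-zeros f xs f≡0)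

sum-tabulate-≢ : ∀ {n} (f g : Fin n → ℕ) j → (∀ x → x ≢ j → f x ≡ g x) →
                 sum (tabulate f) + g j ≡ f j + sum (tabulate g)
sum-tabulate-≢ {suc n} f g Fin.zero f≡g = begin
  f₀ + F + g₀   ≡⟨ ℕₚ.+-assoc f₀ F g₀ ⟩
  f₀ + (F + g₀) ≡⟨ cong (f₀ +_) (ℕₚ.+-comm F g₀) ⟩
  f₀ + (g₀ + F) ≡⟨ cong (λ s → f₀ + (g₀ + sum s)) (Listₚ.tabulate-cong (λ x → f≡g (Fin.suc x) λ ())) ⟩
  f₀ + (g₀ + G) ∎
  where
    open ≡-Reasoning
    f₀ = f Fin.zero
    g₀ = g Fin.zero
    F = sum (tabulate (f ∘ Fin.suc))
    G = sum (tabulate (g ∘ Fin.suc))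
sum-tabulate-≢ {suc n} f g (Fin.suc j) f≡g = begin
  f₀ + F + gⱼ   ≡⟨ ℕₚ.+-assoc f₀ F gⱼ ⟩
  f₀ + (F + gⱼ) ≡⟨ cong (f₀ +_) (sum-tabulate-≢ (f ∘ Fin.suc) (g ∘ Fin.suc) j
                                   (λ x x≢j → f≡g (Fin.suc x) (x≢j ∘ Finₚ.suc-injective))) ⟩
  f₀ + (fⱼ + G) ≡⟨ cong (_+ (fⱼ + G)) (f≡g Fin.zero λ ()) ⟩
  g₀ + (fⱼ + G) ≡⟨ x∙yz≈y∙xz g₀ fⱼ G ⟩
  fⱼ + (g₀ + G) ∎
  where
    open ≡-Reasoning
    f₀ = f Fin.zero
    g₀ = g Fin.zero
    fⱼ = f (Fin.suc j)
    gⱼ = g (Fin.suc j)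
    F = sum (tabulate (f ∘ Fin.suc))
    G = sum (tabulate (g ∘ Fin.suc))

sumDiff-updateAt : ∀ (b : Fin n → Fin n) j →
                   sumDiff b ≡ (toℕ j ∸ toℕ (b j)) + sumDiff (updateAt b j (const j))
sumDiff-updateAt {n} b j = begin
  sumDiff b                                   ≡⟨ cong sum (Listₚ.map-tabulate id d) ⟩
  sum (tabulate d)                            ≡⟨ ℕₚ.+-identityʳ _ ⟨
  sum (tabulate d) + 0                        ≡⟨ cong (sum (tabulate d) +_) d′-j ⟨
  sum (tabulate d) + d′ j                     ≡⟨ sum-tabulate-≢ d d′ j d≡d′ ⟩
  d j + sum (tabulate d′)                     ≡⟨ cong (λ l → d j + sum l) (Listₚ.map-tabulate id d′) ⟨
  d j + sumDiff (updateAt b j (const j))      ∎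
  where
    open ≡-Reasoning
    d d′ : Fin n → ℕ
    d  x = toℕ x ∸ toℕ (b x)
    d′ x = toℕ x ∸ toℕ (updateAt b j (const j) x)
    d′-j : d′ j ≡ 0
    d′-j = trans (cong (λ y → toℕ j ∸ toℕ y) (updateAt-updates j b)) (ℕₚ.n∸n≡0 (toℕ j))
    d≡d′ : ∀ x → x ≢ j → d x ≡ d′ x
    d≡d′ x x≢j = cong (λ y → toℕ x ∸ toℕ y) (sym (updateAt-minimal x j b x≢j))

sorOf-descending : ∀ (rs : List (Fin n × Fin n)) → Descending rs →
                   ∀ {b} → (∀ x → FirstBelow (prodT rs) x x (b x)) → sorOf rs ≡ sumDiff b
sorOf-descending [] _ {b} walks =
  sym (sum-map-zeros _ (allFin _) λ x →
    trans (cong (λ y → toℕ x ∸ toℕ y) (FirstBelow-fixedPoint refl (walks x))) (ℕₚ.n∸n≡0 (toℕ x)))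
sorOf-descending ((i , j) ∷ rs) (i<j ∷ lts , below-j ∷ aps) {b} walks = begin
  (toℕ j ∸ toℕ i) + sorOf rs
    ≡⟨ cong (toℕ j ∸ toℕ i +_) (sorOf-descending rs (lts , aps) (walks-updateAt walks)) ⟩
  (toℕ j ∸ toℕ i) + sumDiff b′
    ≡⟨ cong (λ y → toℕ j ∸ toℕ y + sumDiff b′) (b-j walks) ⟨
  (toℕ j ∸ toℕ (b j)) + sumDiff b′
    ≡⟨ sumDiff-updateAt b j ⟨
  sumDiff b
    ∎
  where
    open ≡-Reasoning
    b′ : Fin _ → Fin _
    b′ = updateAt b j (const j)
    rs-fixed : ∀ {y} → j Fin.≤ y → prodT rs y ≡ y
    rs-fixed {y} j≤y = prodT-fixed rs (All.zipWith
      (λ (i′<j′ , j′<j) → (λ y≡i′ → ℕₚ.<⇒≱ (ℕₚ.<-trans i′<j′ j′<j) (subst (j Fin.≤_) y≡i′ j≤y))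
                        , (λ y≡j′ → ℕₚ.<⇒≱ j′<j (subst (j Fin.≤_) y≡j′ j≤y)))
      (lts , below-j))
    open RemoveTransposition i<j (prodT rs) (prodT-injective rs) rs-fixed

sorOf≡sumDiff : ∀ {σ : Permutation′ n} {b} → IsBCode σ b →
                ∀ ts → IsSortDecomp σ ts → sorOf ts ≡ sumDiff b
sorOf≡sumDiff {σ = σ} bc ts decomp@(_ , _ , prodT≗σ) =
  trans (sym (sorOf-reverse ts))
        (sorOf-descending (reverse ts) (IsSortDecomp⇒Descending-reverse {σ = σ} decomp)
          (λ x → FirstBelow-cong σ⁻¹≗prodT-reverse (IsBCode⇒FirstBelow {σ = σ} bc x)))
  where
    σ⁻¹≗prodT-reverse : ∀ z → σ ⟨$⟩ˡ z ≡ prodT (reverse ts) z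
    σ⁻¹≗prodT-reverse z = begin
      σ ⟨$⟩ˡ z                                 ≡⟨ prodT-reverse-inverse ts _ ⟨
      prodT (reverse ts) (prodT ts (σ ⟨$⟩ˡ z)) ≡⟨ cong (prodT (reverse ts)) (prodT≗σ _) ⟩
      prodT (reverse ts) (σ ⟨$⟩ʳ (σ ⟨$⟩ˡ z))   ≡⟨ cong (prodT (reverse ts)) (inverseʳ σ) ⟩
      prodT (reverse ts) z                     ∎
      where open ≡-Reasoning

module _ {A B : Set} (f : A → B) {P : A → Set} (P? : Decidable P)
  (f-injectiveOn-P : ∀ {x y} → P x → P y → f x ≡ f y → x ≡ y) where

  Unique-map-injectiveOn : ∀ {xs} → All P xs → Unique xs → Unique (map f xs)
  Unique-map-injectiveOn []         []           = []
  Unique-map-injectiveOn (px ∷ pxs) (x∉xs ∷ xs!) =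
    Allₚ.map⁺ (All.zipWith (λ (py , x≢y) fx≡fy → x≢y (f-injectiveOn-P px py fx≡fy)) (pxs , x∉xs))
    ∷ Unique-map-injectiveOn pxs xs!

  length-deduplicate-map : (_≟B_ : DecidableEquality B) → ∀ {xs} → Unique xs → (∀ x → x ∈ xs) →
                           (∀ x → ∃[ r ] P r × f r ≡ f x) →
                           length (deduplicate _≟B_ (map f xs)) ≡ length (filter P? xs)
  length-deduplicate-map _≟B_ {xs} xs! complete representative = begin
    length (deduplicate _≟B_ (map f xs))
      ≡⟨ ↭-length (∼bag⇒↭ (unique∧set⇒bag dedup! image! (mk⇔ to from))) ⟩
    length (map f (filter P? xs))
      ≡⟨ Listₚ.length-map f (filter P? xs) ⟩
    length (filter P? xs)
      ∎
    where
      open ≡-Reasoning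
      dedup! : Unique (deduplicate _≟B_ (map f xs))
      dedup! = deduplicate-! _≟B_ (map f xs)
      image! : Unique (map f (filter P? xs))
      image! = Unique-map-injectiveOn (Allₚ.all-filter P? xs) (Uniqueₚ.filter⁺ P? xs!)
      to : ∀ {z} → z ∈ deduplicate _≟B_ (map f xs) → z ∈ map f (filter P? xs)
      to z∈ with ∈-map⁻ f (Equivalence.from (deduplicate-∈⇔ _≟B_) z∈)
      ... | x , _ , refl with representative x
      ...   | r , pr , fr≡fx =
        subst (_∈ map f (filter P? xs)) fr≡fx (∈-map⁺ f (∈-filter⁺ P? (complete r) pr))
      from : ∀ {z} → z ∈ map f (filter P? xs) → z ∈ deduplicate _≟B_ (map f xs)
      from z∈ with ∈-map⁻ f z∈
      ... | x , _ , refl = Equivalence.to (deduplicate-∈⇔ _≟B_) (∈-map⁺ f (complete x))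

-- Cycles

module Cycles (σ : Permutation′ n) where

  pow-powInv : ∀ k x → pow σ k (powInv σ k x) ≡ x
  pow-powInv = iter-inverseˡ (λ _ → inverseʳ σ)

  powInv-pow : ∀ k x → powInv σ k (pow σ k x) ≡ x
  powInv-pow = iter-inverseˡ (λ _ → inverseˡ σ)

  pow-injective : ∀ k {y z} → pow σ k y ≡ pow σ k z → y ≡ z
  pow-injective k {y} {z} e =
    trans (sym (powInv-pow k y)) (trans (cong (powInv σ k) e) (powInv-pow k z))

  SameCycle : Fin n → Fin n → Set
  SameCycle x y = ∃[ m ] pow σ m x ≡ y

  period : ∀ x → ∃[ p ] suc p ℕ.≤ n × pow σ (suc p) x ≡ x
  period x with Finₚ.pigeonhole (ℕₚ.n<1+n n) (λ (k : Fin (suc n)) → pow σ (toℕ k) x)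
  ... | k , l , k<l , e with toℕ l ∸ toℕ k in d≡
  ...   | zero  = ⊥-elim (ℕₚ.<⇒≢ (ℕₚ.m<n⇒0<n∸m k<l) (sym d≡))
  ...   | suc p =
    p , subst (ℕ._≤ n) d≡ (ℕₚ.≤-trans (ℕₚ.m∸n≤m (toℕ l) (toℕ k)) (Finₚ.toℕ≤pred[n] l))
      , pow-injective (toℕ k) (begin
      pow σ (toℕ k) (pow σ (suc p) x)     ≡⟨ iter-+ (σ ⟨$⟩ʳ_) (toℕ k) (suc p) x ⟨
      pow σ (toℕ k + suc p) x             ≡⟨ cong (λ m → pow σ (toℕ k + m) x) d≡ ⟨
      pow σ (toℕ k + (toℕ l ∸ toℕ k)) x   ≡⟨ cong (λ m → pow σ m x) (ℕₚ.m+[n∸m]≡n (ℕₚ.<⇒≤ k<l)) ⟩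
      pow σ (toℕ l) x                     ≡⟨ e ⟨
      pow σ (toℕ k) x                     ∎)
    where open ≡-Reasoning

  SameCycle-refl : ∀ {x} → SameCycle x x
  SameCycle-refl = 0 , refl

  SameCycle-trans : ∀ {x y z} → SameCycle x y → SameCycle y z → SameCycle x z
  SameCycle-trans (m , refl) (m′ , refl) = m′ + m , iter-+ (σ ⟨$⟩ʳ_) m′ m _

  SameCycle-sym : ∀ {x y} → SameCycle x y → SameCycle y x
  SameCycle-sym {x} (m , refl) with period x
  ... | p , _ , x-periodic = m * suc p ∸ m , (begin
    pow σ (m * suc p ∸ m) (pow σ m x) ≡⟨ iter-+ (σ ⟨$⟩ʳ_) (m * suc p ∸ m) m x ⟨
    pow σ (m * suc p ∸ m + m) x       ≡⟨ cong (λ k → pow σ k x) (ℕₚ.m∸n+n≡m (ℕₚ.m≤m*n m (suc p))) ⟩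
    pow σ (m * suc p) x               ≡⟨ iter-periodic (σ ⟨$⟩ʳ_) x-periodic m ⟩
    x                                 ∎)
    where open ≡-Reasoning

  -- the bounded reachability that orbit decides
  SameCycle< : Fin n → Fin n → Set
  SameCycle< x y = ∃ λ (k : Fin n) → pow σ (toℕ k) x ≡ y

  SameCycle<? : ∀ x y → Dec (SameCycle< x y)
  SameCycle<? x y = any? (λ (k : Fin n) → pow σ (toℕ k) x ≟ y)

  SameCycle⇒SameCycle< : ∀ {x y} → SameCycle x y → SameCycle< x y
  SameCycle⇒SameCycle< {x} (m , e) with period x
  ... | p , p<n , x-periodic =
    fromℕ< m%p<n , trans (cong (λ k → pow σ k x) (Finₚ.toℕ-fromℕ< m%p<n))
                         (trans (sym (iter-% (σ ⟨$⟩ʳ_) x-periodic m)) e)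
    where
      m%p<n : m % suc p ℕ.< n
      m%p<n = ℕₚ.<-≤-trans (m%n<n m (suc p)) p<n

  SameCycle<⇒SameCycle : ∀ {x y} → SameCycle< x y → SameCycle x y
  SameCycle<⇒SameCycle (k , e) = toℕ k , e

  lookup-orbit : ∀ x y → Vec.lookup (orbit σ x) y ≡ true → SameCycle x y
  lookup-orbit x y e = SameCycle<⇒SameCycle
    (toWitness (Equivalence.from T-≡ (trans (isYes≗does (SameCycle<? x y))
                                            (trans (sym (Vecₚ.lookup∘tabulate _ y)) e))))

  orbit-≡⇒SameCycle : ∀ {x y} → orbit σ x ≡ orbit σ y → SameCycle x y
  orbit-≡⇒SameCycle {x} {y} e = lookup-orbit x y (begin
    Vec.lookup (orbit σ x) y ≡⟨ cong (λ o → Vec.lookup o y) e ⟩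
    Vec.lookup (orbit σ y) y ≡⟨ Vecₚ.lookup∘tabulate _ y ⟩
    does (SameCycle<? y y)   ≡⟨ dec-true (SameCycle<? y y) (SameCycle⇒SameCycle< SameCycle-refl) ⟩
    true ∎)
    where open ≡-Reasoning

  SameCycle⇒orbit-≡ : ∀ {x y} → SameCycle x y → orbit σ x ≡ orbit σ y
  SameCycle⇒orbit-≡ {x} {y} x~y = Vecₚ.tabulate-cong λ z → does-⇔
    (mk⇔ (λ x~<z → SameCycle⇒SameCycle< (SameCycle-trans (SameCycle-sym x~y) (SameCycle<⇒SameCycle x~<z)))
         (λ y~<z → SameCycle⇒SameCycle< (SameCycle-trans x~y (SameCycle<⇒SameCycle y~<z))))
    (SameCycle<? x z) (SameCycle<? y z)

  module _ {b : Fin n → Fin n} (bc : IsBCode σ b) where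

    BCode-fixed⇒≤ : ∀ {r y} → b r ≡ r → SameCycle r y → r Fin.≤ y
    BCode-fixed⇒≤ {r} {y} br≡r r~y with SameCycle-sym r~y
    ... | m , e = subst (r Fin.≤_) (trans (cong (powInv σ m) (sym e)) (powInv-pow m y))
                    (FirstBelow-return⇒≤-iter return m)
      where
        return : FirstBelow (σ ⟨$⟩ˡ_) r r r
        return = subst (FirstBelow (σ ⟨$⟩ˡ_) r r) br≡r (IsBCode⇒FirstBelow {σ = σ} bc r)

    SameCycle-BCode : ∀ x → SameCycle (b x) x
    SameCycle-BCode x with bc x
    ... | k , _ , e , _ = k , trans (cong (pow σ k) (sym e)) (pow-powInv k x)

    BCode-representative : ∀ x → ∃[ r ] b r ≡ r × SameCycle r x
    BCode-representative x = descend x (<-wellFounded x)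
      where
        descend : ∀ x → Acc Fin._<_ x → ∃[ r ] b r ≡ r × SameCycle r x
        descend x (acc rec) with b x ≟ x
        ... | yes bx≡x = x , bx≡x , SameCycle-refl
        ... | no bx≢x with bc x
        ...   | _ , _ , _ , bx≤x , _ with descend (b x) (rec (Finₚ.≤∧≢⇒< bx≤x bx≢x))
        ...     | r , br≡r , r~bx = r , br≡r , SameCycle-trans r~bx (SameCycle-BCode x)

    cyc≡maxCount : cyc σ ≡ maxCount b
    cyc≡maxCount = length-deduplicate-map (orbit σ) (λ r → b r ≟ r) orbit-injectiveOn-fixed
      (Vecₚ.≡-dec Bool._≟_) (Uniqueₚ.allFin⁺ n) ∈-allFin
      (λ x → let r , br≡r , r~x = BCode-representative x in r , br≡r , SameCycle⇒orbit-≡ r~x)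
      where
        orbit-injectiveOn-fixed : ∀ {r s} → b r ≡ r → b s ≡ s → orbit σ r ≡ orbit σ s → r ≡ s
        orbit-injectiveOn-fixed br≡r bs≡s e = Finₚ.≤-antisym
          (BCode-fixed⇒≤ br≡r (orbit-≡⇒SameCycle e))
          (BCode-fixed⇒≤ bs≡s (orbit-≡⇒SameCycle (sym e)))

lemma2p3 : (n : ℕ) → 1 ℕ.≤ n → (σ : Permutation′ n) → (b : Fin n → Fin n) →
    IsBCode σ b →
    ((ts : List (Fin n × Fin n)) → IsSortDecomp σ ts → sorOf ts ≡ sumDiff b)
    × (cyc σ ≡ maxCount b)
lemma2p3 n _ σ b bc = sorOf≡sumDiff {σ = σ} bc , Cycles.cyc≡maxCount σ bc
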